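{- In a Semi-BCI algebra $\langle A,\twoheadrightarrow,\rightarrow,\top\rangle$, the relation $\ll$ coincides with $\preceq$ if and only if $\ll$ is reflexive.
   Context: A Semi-BCI (SBCI) algebra is a structure $\langle A,\twoheadrightarrow,\rightarrow,\top\rangle$ with two binary operations $\twoheadrightarrow,\rightarrow$ on $A$ and $\top\in A$, where $x\ll y$ iff $x\twoheadrightarrow y=\top$ and $x\preceq y$ iff $x\rightarrow y=\top$, such that for all $x,y,z\in A$: (S1) $x\twoheadrightarrow(y\twoheadrightarrow z)=y\twoheadrightarrow(x\twoheadrightarrow z)$; (S2) $x\rightarrow(y\rightarrow z)=y\rightarrow(x\rightarrow z)$; (S3) $x\twoheadrightarrow y\preceq(z\twoheadrightarrow x)\rightarrow(z\twoheadrightarrow y)$; (S4) $\top\twoheadrightarrow x=x$; (S5) if $x\ll y\preceq z$ then $x\ll z$; (S6) if $x\preceq y\ll z$ then $x\ll z$; (S7) if $x\preceq y$ and $y\preceq x$ then $x=y$. -}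

module Defs where

open import Level using (Level; suc)
open import Relation.Binary.PropositionalEquality using (_≡_)

record SBCI (a : Level) : Set (suc a) where
  infixr 5 _↠_ _⇒_
  infix 4 _≪_ _≼_
  field
    A   : Set a
    _↠_ : A → A → A
    _⇒_ : A → A → A
    ⊤   : A

  _≪_ : A → A → Set a
  x ≪ y = (x ↠ y) ≡ ⊤

  _≼_ : A → A → Set a
  x ≼ y = (x ⇒ y) ≡ ⊤

  field
    S1 : ∀ x y z → (x ↠ (y ↠ z)) ≡ (y ↠ (x ↠ z))
    S2 : ∀ x y z → (x ⇒ (y ⇒ z)) ≡ (y ⇒ (x ⇒ z))
    S3 : ∀ x y z → (x ↠ y) ≼ ((z ↠ x) ⇒ (z ↠ y))
    S4 : ∀ x → (⊤ ↠ x) ≡ x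
    S5 : ∀ {x y z} → x ≪ y → y ≼ z → x ≪ z
    S6 : ∀ {x y z} → x ≼ y → y ≪ z → x ≪ z
    S7 : ∀ {x y} → x ≼ y → y ≼ x → x ≡ y

module Submission where

-- Three facts hold in every SBCI algebra:
--   (a) ⊤ ≪ w forces w = ⊤                          (axiom S4);
--   (b) (x ↠ y) ≼ (x ⇒ y), i.e. axiom S3 at z = ⊤;   hence
--   (c) x ≪ y implies ⊤ ≼ (x ⇒ y), and ⊤ ≼ (x ⇒ x) always (using S2).
-- If ≪ is reflexive, S6 gives ≼ ⊆ ≪; with (a) this shows that ⊤ ≼ w forces
-- w = ⊤, so (c) turns x ≪ y into x ≼ y.  Conversely, if ≼ ⊆ ≪, then
-- ⊤ ≼ (x ⇒ x) gives ⊤ ≪ (x ⇒ x), hence x ⇒ x = ⊤ by (a); so ≼ is reflexive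
-- and with it ≪.

open import Defs
open import Level using (Level)
open import Function.Bundles using (_⇔_; mk⇔; Equivalence)
open import Relation.Binary.PropositionalEquality
  using (_≡_; sym; trans; cong; cong₂; subst; module ≡-Reasoning)

module _ {a : Level} (S : SBCI a) where
  open SBCI S
  open ≡-Reasoning

  ⊤≪⇒≡⊤ : ∀ {w} → ⊤ ≪ w → w ≡ ⊤
  ⊤≪⇒≡⊤ {w} ⊤≪w = trans (sym (S4 w)) ⊤≪w

  ↠≼⇒ : ∀ x y → (x ↠ y) ≼ (x ⇒ y)
  ↠≼⇒ x y = begin
    (x ↠ y) ⇒ (x ⇒ y)                ≡⟨ cong₂ (λ u v → (x ↠ y) ⇒ (u ⇒ v)) (S4 x) (S4 y) ⟨
    (x ↠ y) ⇒ ((⊤ ↠ x) ⇒ (⊤ ↠ y))    ≡⟨ S3 x y ⊤ ⟩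
    ⊤                                ∎

  ≪⇒⊤≼⇒ : ∀ {x y} → x ≪ y → ⊤ ≼ (x ⇒ y)
  ≪⇒⊤≼⇒ {x} {y} x≪y = subst (λ u → u ≼ (x ⇒ y)) x≪y (↠≼⇒ x y)

  ⊤≼⇒-diag : ∀ x → ⊤ ≼ (x ⇒ x)
  ⊤≼⇒-diag x = begin
    ⊤ ⇒ (x ⇒ x)          ≡⟨ S2 ⊤ x x ⟩
    x ⇒ (⊤ ⇒ x)          ≡⟨ cong (_⇒ (⊤ ⇒ x)) (S4 x) ⟨
    (⊤ ↠ x) ⇒ (⊤ ⇒ x)    ≡⟨ ↠≼⇒ ⊤ x ⟩
    ⊤                    ∎

  ≼⊆≪⇒≪-refl : (∀ {x y} → x ≼ y → x ≪ y) → ∀ x → x ≪ x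
  ≼⊆≪⇒≪-refl ≼⊆≪ x = ≼⊆≪ (⊤≪⇒≡⊤ (≼⊆≪ (⊤≼⇒-diag x)))

  ≪-refl⇒≼⊆≪ : (∀ x → x ≪ x) → ∀ {x y} → x ≼ y → x ≪ y
  ≪-refl⇒≼⊆≪ ≪-refl x≼y = S6 x≼y (≪-refl _)

  ≪-refl⇒≪⊆≼ : (∀ x → x ≪ x) → ∀ {x y} → x ≪ y → x ≼ y
  ≪-refl⇒≪⊆≼ ≪-refl x≪y = ⊤≪⇒≡⊤ (≪-refl⇒≼⊆≪ ≪-refl (≪⇒⊤≼⇒ x≪y))

proposition9 : ∀ {a : Level} (S : SBCI a) → let open SBCI S in
    (∀ x y → (x ≪ y) ⇔ (x ≼ y)) ⇔ (∀ x → x ≪ x)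
proposition9 S = mk⇔ coincide⇒refl refl⇒coincide
  where
  open SBCI S

  coincide⇒refl : (∀ x y → (x ≪ y) ⇔ (x ≼ y)) → ∀ x → x ≪ x
  coincide⇒refl ≪⇔≼ = ≼⊆≪⇒≪-refl S (λ {x} {y} → Equivalence.from (≪⇔≼ x y))

  refl⇒coincide : (∀ x → x ≪ x) → ∀ x y → (x ≪ y) ⇔ (x ≼ y)
  refl⇒coincide ≪-refl x y = mk⇔ (≪-refl⇒≪⊆≼ S ≪-refl) (≪-refl⇒≼⊆≪ S ≪-refl)
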